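{- Let $\Pi$ be a projective plane of order $p^2$, $p\geq3$ prime, let $c\in\mathrm{C}(\Pi)^\perp$ have weight $2p^2-2p+2+\epsilon$ with $1\leq\epsilon\leq p-2$, let $\mathcal{S}$ be its support, and for $\lambda\in\{1,\dots,p-1\}$ let $K_\lambda$ be the set of points where $c$ has entry $\lambda$. For $A\in\mathcal{S}$ let $x_A$ be the number of lines through $A$ meeting $\mathcal{S}$ in exactly $2$ points (2-secants); a $k$-secant is a line meeting $\mathcal{S}$ in exactly $k$ points. Then: (i) for every $\lambda$ and every $A\in K_\lambda$, $x_A\leq|K_{p-\lambda}|$; (ii) if $|K_{p-\lambda}|=2p+1-\epsilon$, then $x_P=2p+1-\epsilon$ for all $P\in K_\lambda$; (iii) if $x_P=2p+1-\epsilon$ for some $P\in K_\lambda$, then $|K_{p-\lambda}|=2p+1-\epsilon$, every line through $P$ is a 2-secant or a 3-secant, and the points of $K_{p-\lambda}$ are exactly the points of $\mathcal{S}\setminus\{P\}$ on the 2-secants through $P$; (iv) if $|K_{p-\lambda}|=2p+2-\epsilon$, then for all $P\in K_\lambda$, $x_P=2p+2-\epsilon$, and $P$ lies on exactly $2p+2-\epsilon$ 2-secants, $p^2-2p-2+\epsilon$ 3-secants and one 4-secant.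
   Context: $\mathrm{C}(\Pi)$ is the $\mathbb{F}_p$-span of the incidence vectors of the lines of $\Pi$, viewed as vectors indexed by points; $\mathrm{C}(\Pi)^\perp$ is the set of vectors $v$ with $\sum_{P\in\ell}v_P=0$ in $\mathbb{F}_p$ for every line $\ell$. The support is the set of points with non-zero entry and the weight is its size. Elements of $\mathbb{F}_p$ are represented by integers in $\{0,\dots,p-1\}$. -}

module Defs where

open import Data.Nat using (ℕ; zero; suc; _+_; _*_; _∸_; _≡ᵇ_)
open import Data.Nat.Divisibility using (_∣_)
open import Data.Fin using (Fin; toℕ) renaming (zero to fzero; suc to fsuc)
open import Data.Bool using (Bool; true; false; if_then_else_; _∧_; not)
open import Data.Product using (Σ; _×_; _,_)
open import Relation.Binary.PropositionalEquality using (_≡_; _≢_)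
open import Function using (_∘_)

count : ∀ {m} → (Fin m → Bool) → ℕ
count {zero}  f = 0
count {suc m} f = (if f fzero then 1 else 0) + count (f ∘ fsuc)

sumOver : ∀ {m} → (Fin m → Bool) → (Fin m → ℕ) → ℕ
sumOver {zero}  P g = 0
sumOver {suc m} P g = (if P fzero then g fzero else 0) + sumOver (P ∘ fsuc) (g ∘ fsuc)

numPts : ℕ → ℕ
numPts n = n * n + n + 1

Point : ℕ → Set
Point n = Fin (numPts n)

Line : ℕ → Set
Line n = Fin (numPts n)

record ProjectivePlane (n : ℕ) : Set where
  field
    I : Point n → Line n → Bool
    joinLine : ∀ (P Q : Point n) → P ≢ Q →
      Σ (Line n) λ ℓ → (I P ℓ ≡ true) × (I Q ℓ ≡ true) ×
        (∀ m → I P m ≡ true → I Q m ≡ true → m ≡ ℓ)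
    meetPoint : ∀ (ℓ m : Line n) → ℓ ≢ m →
      Σ (Point n) λ P → (I P ℓ ≡ true) × (I P m ≡ true) ×
        (∀ Q → I Q ℓ ≡ true → I Q m ≡ true → Q ≡ P)
    quadrangle : Σ (Point n) λ A → Σ (Point n) λ B → Σ (Point n) λ C → Σ (Point n) λ D →
      (∀ ℓ → ((I A ℓ ∧ I B ℓ ∧ I C ℓ) ≡ false) × ((I A ℓ ∧ I B ℓ ∧ I D ℓ) ≡ false)
           × ((I A ℓ ∧ I C ℓ ∧ I D ℓ) ≡ false) × ((I B ℓ ∧ I C ℓ ∧ I D ℓ) ≡ false))
    lineSize : ∀ ℓ → count (λ P → I P ℓ) ≡ suc n

module _ {n p : ℕ} (Π : ProjectivePlane n) (c : Point n → Fin p) where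
  open ProjectivePlane Π

  -- c ∈ C(Π)^⊥ : entries on every line sum to 0 in F_p
  InDual : Set
  InDual = ∀ (ℓ : Line n) → p ∣ sumOver (λ P → I P ℓ) (λ P → toℕ (c P))

  inS : Point n → Bool
  inS P = not (toℕ (c P) ≡ᵇ 0)

  weight : ℕ
  weight = count inS

  inK : ℕ → Point n → Bool
  inK l P = toℕ (c P) ≡ᵇ l

  sizeK : ℕ → ℕ
  sizeK l = count (inK l)

  secant : Line n → ℕ
  secant ℓ = count (λ P → I P ℓ ∧ inS P)

  nSecantsThrough : ℕ → Point n → ℕ
  nSecantsThrough k A = count (λ ℓ → I A ℓ ∧ (secant ℓ ≡ᵇ k))

  x : Point n → ℕ
  x A = nSecantsThrough 2 A

-- Fix P ∈ K_λ. The entries of c on a line through P sum to 0 mod p, so no line through P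
-- meets S in P alone, the second point of S on a 2-secant through P lies in K_{p−λ}, and a
-- 3-secant through P contains no point of K_{p−λ} (its third entry would be ≡ 0). Hence
-- every line ℓ through P has |ℓ ∩ S| + [ℓ is a 2-secant] ≥ 3, with equality exactly for 2- and
-- 3-secants. The p² + 1 lines through P cover S ∖ {P} exactly once, so the total excess over 3
-- is x_P + ε − (2p + 1); and x_P ≤ |K_{p−λ}| because every 2-secant through P carries a point
-- of K_{p−λ}. Excess 0 means that all lines through P are 2- or 3-secants, and then K_{p−λ}
-- consists of the second points of the 2-secants. If |K_{p−λ}| = 2p + 2 − ε, excess 0 is thus
-- impossible, and excess 1 is a single 4-secant.

{-# OPTIONS --safe #-}
module Submission where

open import Defs
open import Data.Nat using (ℕ; zero; suc; _+_; _*_; _∸_; _≤_; _<_; _≡ᵇ_; z≤n; s≤s; NonZero; >-nonZero)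
open import Data.Nat.Properties hiding (_≟_)
open import Algebra.Properties.CommutativeSemigroup +-commutativeSemigroup using (x∙yz≈y∙xz; interchange)
open import Algebra.Properties.Semiring.Sum +-*-semiring using (sum; sum-cong-≗; sum-replicate-zero; ∑-comm)
open import Data.Fin using (Fin; toℕ; _≟_) renaming (zero to fzero; suc to fsuc)
open import Data.Fin.Properties using (toℕ<n)
open import Data.Bool using (Bool; true; false; if_then_else_; _∧_; not)
open import Data.Bool.Properties using (T-≡; ∧-comm; ∧-assoc; ∧-zeroʳ; ∧-identityʳ)
open import Data.Product using (Σ; _×_; _,_; proj₁; proj₂)
open import Data.Empty using (⊥; ⊥-elim)
open import Data.Sum using (_⊎_; inj₁; inj₂)
open import Data.Nat.Divisibility using (_∣_; divides; >⇒∤; ∣m+n∣m⇒∣n; ∣-refl)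
open import Data.Nat.Primality using (Prime; prime⇒irreducible)
open import Function.Bundles using (_⇔_; mk⇔; Equivalence)
open import Relation.Nullary using (¬_; does; yes; no)
open import Relation.Binary.PropositionalEquality
open import Function using (_∘_; case_of_)
open import Data.Nat.Tactic.RingSolver using (solve-∀)


∧-true : ∀ {a b} → a ∧ b ≡ true → (a ≡ true) × (b ≡ true)
∧-true {true} {true} _ = refl , refl

∧-intro : ∀ {a b} → a ≡ true → b ≡ true → a ∧ b ≡ true
∧-intro refl refl = refl

𝟙 : Bool → ℕ
𝟙 b = if b then 1 else 0

_without_ : ∀ {m} → (Fin m → Bool) → Fin m → Fin m → Bool
(f without a) i = if does (i ≟ a) then false else f i

without-self : ∀ {m} (f : Fin m → Bool) a → (f without a) a ≡ false
without-self f a with a ≟ a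
... | yes _   = refl
... | no a≢a = ⊥-elim (a≢a refl)

without-⊆ : ∀ {m} {f : Fin m → Bool} {a i} → (f without a) i ≡ true → f i ≡ true
without-⊆ {a = a} {i} i∈ with does (i ≟ a)
... | false = i∈

without-≢ : ∀ {m} {f : Fin m → Bool} {a i} → (f without a) i ≡ true → i ≢ a
without-≢ {a = a} {i} i∈ with i ≟ a
... | no i≢a = i≢a

∈-without : ∀ {m} {f : Fin m → Bool} {a i} → f i ≡ true → i ≢ a → (f without a) i ≡ true
∈-without {a = a} {i} fi i≢a with i ≟ a
... | yes i≡a = ⊥-elim (i≢a i≡a)
... | no _    = fi

∧-without : ∀ {m} (f g : Fin m → Bool) a i → f i ∧ (g without a) i ≡ ((λ j → f j ∧ g j) without a) i
∧-without f g a i with does (i ≟ a)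
... | true  = ∧-zeroʳ (f i)
... | false = refl

-- Counting and summing over a predicate

count-as-sum : ∀ {m} (f : Fin m → Bool) → count f ≡ sum (𝟙 ∘ f)
count-as-sum {zero}  f = refl
count-as-sum {suc m} f = cong (𝟙 (f fzero) +_) (count-as-sum (f ∘ fsuc))

count-as-sumOver : ∀ {m} (f : Fin m → Bool) → count f ≡ sumOver f (λ _ → 1)
count-as-sumOver {zero}  f = refl
count-as-sumOver {suc m} f = cong (𝟙 (f fzero) +_) (count-as-sumOver (f ∘ fsuc))

count-all : ∀ {m} → count {m} (λ _ → true) ≡ m
count-all {zero}  = refl
count-all {suc m} = cong suc (count-all {m})

count-cong : ∀ {m} {f h : Fin m → Bool} → (∀ i → f i ≡ h i) → count f ≡ count h
count-cong {f = f} {h} f≗h = begin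
  count f        ≡⟨ count-as-sum f ⟩
  sum (𝟙 ∘ f)    ≡⟨ sum-cong-≗ (cong 𝟙 ∘ f≗h) ⟩
  sum (𝟙 ∘ h)    ≡⟨ count-as-sum h ⟨
  count h        ∎
  where open ≡-Reasoning

count-mono : ∀ {m} {f h : Fin m → Bool} → (∀ i → f i ≡ true → h i ≡ true) → count f ≤ count h
count-mono {zero}  f⊆h = z≤n
count-mono {suc m} {f} {h} f⊆h with f fzero in f0 | h fzero in h0
... | true  | true  = s≤s (count-mono (f⊆h ∘ fsuc))
... | false | true  = m≤n⇒m≤1+n (count-mono (f⊆h ∘ fsuc))
... | false | false = count-mono (f⊆h ∘ fsuc)
... | true  | false with () ← trans (sym (f⊆h fzero f0)) h0

count-none : ∀ {m} (f : Fin m → Bool) → (∀ i → f i ≢ true) → count f ≡ 0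
count-none {zero}  f ∉f = refl
count-none {suc m} f ∉f with f fzero in f0
... | true  = ⊥-elim (∉f fzero f0)
... | false = count-none (f ∘ fsuc) (∉f ∘ fsuc)

count-pos : ∀ {m} (f : Fin m → Bool) {k} → count f ≡ suc k → Σ (Fin m) λ a → f a ≡ true
count-pos {suc m} f c≡ with f fzero in f0
... | true  = fzero , f0
... | false = let a , fa = count-pos (f ∘ fsuc) c≡ in fsuc a , fa

count-∧ : ∀ {m} (f h : Fin m → Bool) → count (λ i → f i ∧ h i) ≡ sumOver f (𝟙 ∘ h)
count-∧ {zero}  f h = refl
count-∧ {suc m} f h with f fzero
... | true  = cong (𝟙 (h fzero) +_) (count-∧ (f ∘ fsuc) (h ∘ fsuc))
... | false = count-∧ (f ∘ fsuc) (h ∘ fsuc)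

sumOver-cong : ∀ {m} (f : Fin m → Bool) {g h : Fin m → ℕ} →
  (∀ i → f i ≡ true → g i ≡ h i) → sumOver f g ≡ sumOver f h
sumOver-cong {zero}  f g≡h = refl
sumOver-cong {suc m} f g≡h with f fzero in f0
... | true  = cong₂ _+_ (g≡h fzero f0) (sumOver-cong (f ∘ fsuc) (g≡h ∘ fsuc))
... | false = sumOver-cong (f ∘ fsuc) (g≡h ∘ fsuc)

sumOver-mono-≤ : ∀ {m} (f : Fin m → Bool) {g h : Fin m → ℕ} →
  (∀ i → f i ≡ true → g i ≤ h i) → sumOver f g ≤ sumOver f h
sumOver-mono-≤ {zero}  f g≤h = z≤n
sumOver-mono-≤ {suc m} f g≤h with f fzero in f0
... | true  = +-mono-≤ (g≤h fzero f0) (sumOver-mono-≤ (f ∘ fsuc) (g≤h ∘ fsuc))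
... | false = sumOver-mono-≤ (f ∘ fsuc) (g≤h ∘ fsuc)

sumOver-+ : ∀ {m} (f : Fin m → Bool) (g h : Fin m → ℕ) →
  sumOver f (λ i → g i + h i) ≡ sumOver f g + sumOver f h
sumOver-+ {zero}  f g h = refl
sumOver-+ {suc m} f g h with f fzero
... | true  = trans (cong (g fzero + h fzero +_) (sumOver-+ (f ∘ fsuc) (g ∘ fsuc) (h ∘ fsuc)))
                    (interchange (g fzero) (h fzero) _ _)
... | false = sumOver-+ (f ∘ fsuc) (g ∘ fsuc) (h ∘ fsuc)

sumOver-const : ∀ {m} (f : Fin m → Bool) k → sumOver f (λ _ → k) ≡ k * count f
sumOver-const {zero}  f k = sym (*-zeroʳ k)
sumOver-const {suc m} f k with f fzero
... | true  = trans (cong (k +_) (sumOver-const (f ∘ fsuc) k)) (sym (*-suc k _))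
... | false = sumOver-const (f ∘ fsuc) k

sumOver-term-≤ : ∀ {m} (f : Fin m → Bool) (g : Fin m → ℕ) {i} → f i ≡ true → g i ≤ sumOver f g
sumOver-term-≤ {suc m} f g {fzero} fi rewrite fi = m≤m+n (g fzero) _
sumOver-term-≤ {suc m} f g {fsuc i} fi =
  ≤-trans (sumOver-term-≤ (f ∘ fsuc) (g ∘ fsuc) fi) (m≤n+m _ (if f fzero then g fzero else 0))

sumOver-count≡0 : ∀ {m} (f : Fin m → Bool) (g : Fin m → ℕ) → count f ≡ 0 → sumOver f g ≡ 0
sumOver-count≡0 {zero}  f g _ = refl
sumOver-count≡0 {suc m} f g c≡0 with f fzero
... | true with () ← c≡0
... | false = sumOver-count≡0 (f ∘ fsuc) (g ∘ fsuc) c≡0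

sumOver-restrict : ∀ {m} (f h : Fin m → Bool) (g : Fin m → ℕ) → (∀ i → h i ≡ false → g i ≡ 0) →
  sumOver f g ≡ sumOver (λ i → f i ∧ h i) g
sumOver-restrict {zero}  f h g vanish = refl
sumOver-restrict {suc m} f h g vanish with f fzero | h fzero in h0
... | true  | true  = cong (g fzero +_) (sumOver-restrict (f ∘ fsuc) (h ∘ fsuc) (g ∘ fsuc) (vanish ∘ fsuc))
... | true  | false =
  cong₂ _+_ (vanish fzero h0) (sumOver-restrict (f ∘ fsuc) (h ∘ fsuc) (g ∘ fsuc) (vanish ∘ fsuc))
... | false | _     = sumOver-restrict (f ∘ fsuc) (h ∘ fsuc) (g ∘ fsuc) (vanish ∘ fsuc)

sumOver-without : ∀ {m} (f : Fin m → Bool) (g : Fin m → ℕ) {a} → f a ≡ true →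
  sumOver f g ≡ g a + sumOver (f without a) g
sumOver-without {suc m} f g {fzero}  fa rewrite fa = refl
sumOver-without {suc m} f g {fsuc a} fa =
  trans (cong (head +_) (sumOver-without (f ∘ fsuc) (g ∘ fsuc) fa))
        (x∙yz≈y∙xz head (g (fsuc a)) (sumOver ((f ∘ fsuc) without a) (g ∘ fsuc)))
  where
  head : ℕ
  head = if f fzero then g fzero else 0

count-without : ∀ {m} (f : Fin m → Bool) {a} → f a ≡ true → count f ≡ suc (count (f without a))
count-without f {a} fa = begin
  count f                               ≡⟨ count-as-sumOver f ⟩
  sumOver f (λ _ → 1)                   ≡⟨ sumOver-without f (λ _ → 1) fa ⟩
  suc (sumOver (f without a) (λ _ → 1)) ≡⟨ cong suc (count-as-sumOver (f without a)) ⟨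
  suc (count (f without a))             ∎
  where open ≡-Reasoning

sumOver-single : ∀ {m} (f : Fin m → Bool) (g : Fin m → ℕ) {a} → f a ≡ true → count f ≡ 1 →
  sumOver f g ≡ g a
sumOver-single f g {a} fa c≡1 = begin
  sumOver f g                     ≡⟨ sumOver-without f g fa ⟩
  g a + sumOver (f without a) g   ≡⟨ cong (g a +_) (sumOver-count≡0 (f without a) g rest≡0) ⟩
  g a + 0                         ≡⟨ +-identityʳ (g a) ⟩
  g a                             ∎
  where
  open ≡-Reasoning
  rest≡0 : count (f without a) ≡ 0
  rest≡0 = suc-injective (trans (sym (count-without f fa)) c≡1)

count-unique : ∀ {m} (f : Fin m → Bool) {a} → f a ≡ true → (∀ j → f j ≡ true → j ≡ a) → count f ≡ 1
count-unique f {a} fa unique = begin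
  count f                   ≡⟨ count-without f fa ⟩
  suc (count (f without a)) ≡⟨ cong suc (count-none (f without a) nothing-else) ⟩
  1                         ∎
  where
  open ≡-Reasoning
  nothing-else : ∀ j → (f without a) j ≢ true
  nothing-else j j∈ = without-≢ {f = f} j∈ (unique j (without-⊆ {f = f} j∈))

sumOver-count-as-∑∑ : ∀ {m k} (f : Fin m → Bool) (h : Fin m → Fin k → Bool) →
  sumOver f (λ i → count (h i)) ≡ sum (λ i → sum (λ j → 𝟙 (f i ∧ h i j)))
sumOver-count-as-∑∑ {zero}      f h = refl
sumOver-count-as-∑∑ {suc m} {k} f h = cong₂ _+_ first (sumOver-count-as-∑∑ (f ∘ fsuc) (h ∘ fsuc))
  where
  first : (if f fzero then count (h fzero) else 0) ≡ sum (λ j → 𝟙 (f fzero ∧ h fzero j))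
  first with f fzero
  ... | true  = count-as-sum (h fzero)
  ... | false = sym (sum-replicate-zero k)

sumOver-count-comm : ∀ {m k} (f : Fin m → Bool) (g : Fin k → Bool) (r : Fin m → Fin k → Bool) →
  sumOver f (λ i → count (λ j → r i j ∧ g j)) ≡ sumOver g (λ j → count (λ i → f i ∧ r i j))
sumOver-count-comm f g r = begin
  sumOver f (λ i → count (λ j → r i j ∧ g j))    ≡⟨ sumOver-count-as-∑∑ f (λ i j → r i j ∧ g j) ⟩
  sum (λ i → sum (λ j → 𝟙 (f i ∧ (r i j ∧ g j)))) ≡⟨ ∑-comm (λ i j → 𝟙 (f i ∧ (r i j ∧ g j))) ⟩
  sum (λ j → sum (λ i → 𝟙 (f i ∧ (r i j ∧ g j)))) ≡⟨ sum-cong-≗ (λ j → sum-cong-≗ (λ i →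
                                                       cong 𝟙 (rotate (f i) (r i j) (g j)))) ⟩
  sum (λ j → sum (λ i → 𝟙 (g j ∧ (f i ∧ r i j)))) ≡⟨ sumOver-count-as-∑∑ g (λ j i → f i ∧ r i j) ⟨
  sumOver g (λ j → count (λ i → f i ∧ r i j))    ∎
  where
  open ≡-Reasoning
  rotate : ∀ a b c → a ∧ (b ∧ c) ≡ c ∧ (a ∧ b)
  rotate a b c = trans (sym (∧-assoc a b c)) (∧-comm (a ∧ b) c)

-- Double counting through a point of a projective plane

module _ {n : ℕ} (Π : ProjectivePlane n) where
  open ProjectivePlane Π

  count-by-linesThrough : ∀ P (g : Point n → Bool) → g P ≡ false →
    count g ≡ sumOver (λ ℓ → I P ℓ) (λ ℓ → count (λ Q → I Q ℓ ∧ g Q))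
  count-by-linesThrough P g gP≡false = begin
    count g
      ≡⟨ count-as-sumOver g ⟩
    sumOver g (λ _ → 1)
      ≡⟨ sumOver-cong g one-join ⟨
    sumOver g (λ Q → count (λ ℓ → I P ℓ ∧ I Q ℓ))
      ≡⟨ sumOver-count-comm (λ ℓ → I P ℓ) g (λ ℓ Q → I Q ℓ) ⟨
    sumOver (λ ℓ → I P ℓ) (λ ℓ → count (λ Q → I Q ℓ ∧ g Q))
      ∎
    where
    open ≡-Reasoning
    one-join : ∀ Q → g Q ≡ true → count (λ ℓ → I P ℓ ∧ I Q ℓ) ≡ 1
    one-join Q gQ with joinLine P Q (λ { refl → case trans (sym gQ) gP≡false of λ () })
    ... | ℓ , P∈ℓ , Q∈ℓ , unique =
      count-unique _ (∧-intro P∈ℓ Q∈ℓ)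
        (λ m PQ∈m → let P∈m , Q∈m = ∧-true PQ∈m in unique m P∈m Q∈m)

  count-linesThrough : .{{NonZero n}} → ∀ P → count (λ ℓ → I P ℓ) ≡ suc n
  count-linesThrough P = *-cancelˡ-≡ _ _ n (begin
    n * count (λ ℓ → I P ℓ)
      ≡⟨ sumOver-const (λ ℓ → I P ℓ) n ⟨
    sumOver (λ ℓ → I P ℓ) (λ _ → n)
      ≡⟨ sumOver-cong (λ ℓ → I P ℓ) others-on-line ⟨
    sumOver (λ ℓ → I P ℓ) (λ ℓ → count (λ Q → I Q ℓ ∧ notP Q))
      ≡⟨ count-by-linesThrough P notP (without-self _ P) ⟨
    count notP
      ≡⟨ suc-injective (trans (sym (count-without (λ _ → true) {P} refl)) (trans count-all (+-comm _ 1))) ⟩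
    n * n + n
      ≡⟨ trans (+-comm (n * n) n) (sym (*-suc n n)) ⟩
    n * suc n
      ∎)
    where
    open ≡-Reasoning
    notP : Point n → Bool
    notP = (λ _ → true) without P
    others-on-line : ∀ ℓ → I P ℓ ≡ true → count (λ Q → I Q ℓ ∧ notP Q) ≡ n
    others-on-line ℓ P∈ℓ = begin
      count (λ Q → I Q ℓ ∧ notP Q)
        ≡⟨ count-cong (λ Q → trans (∧-without (λ Q → I Q ℓ) _ P Q)
                                   (cong (λ b → if does (Q ≟ P) then false else b) (∧-identityʳ (I Q ℓ)))) ⟩
      count ((λ Q → I Q ℓ) without P)
        ≡⟨ suc-injective (trans (sym (count-without (λ Q → I Q ℓ) P∈ℓ)) (lineSize ℓ)) ⟩
      n
        ∎

≡ᵇ-true⇒≡ : ∀ {m n} → (m ≡ᵇ n) ≡ true → m ≡ n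
≡ᵇ-true⇒≡ {m} {n} e = ≡ᵇ⇒≡ m n (Equivalence.from T-≡ e)

≡⇒≡ᵇ-true : ∀ {m n} → m ≡ n → (m ≡ᵇ n) ≡ true
≡⇒≡ᵇ-true {m} {n} e = Equivalence.to T-≡ (≡⇒≡ᵇ m n e)

≢⇒≡ᵇ-false : ∀ {m n} → m ≢ n → (m ≡ᵇ n) ≡ false
≢⇒≡ᵇ-false {m} {n} m≢n with m ≡ᵇ n in e
... | true  = ⊥-elim (m≢n (≡ᵇ-true⇒≡ e))
... | false = refl

≢0-false⇒≡0 : ∀ v → not (v ≡ᵇ 0) ≡ false → v ≡ 0
≢0-false⇒≡0 zero _ = refl

≢0-true⇒>0 : ∀ v → not (v ≡ᵇ 0) ≡ true → 0 < v
≢0-true⇒>0 (suc v) _ = s≤s z≤n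

>0⇒≢0-true : ∀ v → 0 < v → not (v ≡ᵇ 0) ≡ true
>0⇒≢0-true (suc v) _ = refl

∣a+b⇒b≡p∸a : ∀ {p a b} → 0 < a → a < p → b < p → p ∣ a + b → b ≡ p ∸ a
∣a+b⇒b≡p∸a {a = a} 0<a _ _ (divides zero a+b≡0) =
  ⊥-elim (<⇒≢ 0<a (sym (m+n≡0⇒m≡0 a a+b≡0)))
∣a+b⇒b≡p∸a {p} {a} {b} _ _ _ (divides 1 a+b≡p) = begin
  b           ≡⟨ m+n∸m≡n a b ⟨
  a + b ∸ a   ≡⟨ cong (_∸ a) (trans a+b≡p (+-identityʳ p)) ⟩
  p ∸ a       ∎
  where open ≡-Reasoning
∣a+b⇒b≡p∸a {p} _ a<p b<p (divides (suc (suc k)) a+b≡[2+k]p) =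
  ⊥-elim (<-irrefl a+b≡[2+k]p (<-≤-trans (+-mono-< a<p b<p) (+-monoʳ-≤ p (m≤m+n p (k * p)))))

p∤p+b : ∀ {p b} → 0 < b → b < p → ¬ (p ∣ p + b)
p∤p+b {p} {b@(suc _)} 0<b b<p p∣p+b = >⇒∤ b<p (∣m+n∣m⇒∣n p∣p+b ∣-refl)

odd-prime⇒l≢p∸l : ∀ {p l} → Prime p → 3 ≤ p → l ≤ p → l ≢ p ∸ l
odd-prime⇒l≢p∸l {p} {l} p-prime 3≤p l≤p l≡p∸l with prime⇒irreducible p-prime {2} (divides l p≡l*2)
  where
  p≡l*2 : p ≡ l * 2
  p≡l*2 = begin
    p             ≡⟨ m+[n∸m]≡n l≤p ⟨
    l + (p ∸ l)   ≡⟨ cong (l +_) l≡p∸l ⟨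
    l + l         ≡⟨ cong (l +_) (+-identityʳ l) ⟨
    2 * l         ≡⟨ *-comm 2 l ⟩
    l * 2         ∎
    where open ≡-Reasoning
... | inj₂ 2≡p = <⇒≱ (s≤s (s≤s (s≤s z≤n))) (subst (3 ≤_) (sym 2≡p) 3≤p)

secantExcess : ℕ → ℕ
secantExcess s = s + 𝟙 (s ≡ᵇ 2) ∸ 3

secantExcess-+3 : ∀ s → 2 ≤ s → secantExcess s + 3 ≡ s + 𝟙 (s ≡ᵇ 2)
secantExcess-+3 s 2≤s = m∸n+n≡m (bound s 2≤s)
  where
  bound : ∀ s → 2 ≤ s → 3 ≤ s + 𝟙 (s ≡ᵇ 2)
  bound 1                   (s≤s ())
  bound 2                   _ = ≤-refl
  bound (suc (suc (suc k))) _ = s≤s (s≤s (s≤s z≤n))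

secantExcess≡0 : ∀ s → 2 ≤ s → secantExcess s ≡ 0 → (s ≡ 2) ⊎ (s ≡ 3)
secantExcess≡0 1 (s≤s ()) _
secantExcess≡0 2 _ _ = inj₁ refl
secantExcess≡0 3 _ _ = inj₂ refl

secantExcess≤1 : ∀ s → 2 ≤ s → secantExcess s ≤ 1 →
  (𝟙 (s ≡ᵇ 2) + 𝟙 (s ≡ᵇ 3) + 𝟙 (s ≡ᵇ 4) ≡ 1) × (𝟙 (s ≡ᵇ 4) ≡ secantExcess s)
secantExcess≤1 1 (s≤s ()) _
secantExcess≤1 2 _ _ = refl , refl
secantExcess≤1 3 _ _ = refl , refl
secantExcess≤1 4 _ _ = refl , refl
secantExcess≤1 (suc (suc (suc (suc (suc k))))) _ (s≤s ())

excess-balance : ∀ {E w x q p ε} → E + 3 * suc q ≡ w + q + x → w ≡ 2 * q + 2 + ε ∸ 2 * p →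
  2 * p ≤ 2 * q + 2 + ε → ε ≤ 2 * p + 1 → x ≡ E + (2 * p + 1 ∸ ε)
excess-balance {E} {w} {x} {q} {p} {ε} counted w≡ 2p≤ ε≤ = begin
  x                        ≡⟨ m+n∸n≡m x ε ⟨
  x + ε ∸ ε                ≡⟨ cong (_∸ ε) (+-cancelʳ-≡ (w + q + 2 * p) (x + ε) (E + (2 * p + 1)) balance) ⟩
  E + (2 * p + 1) ∸ ε      ≡⟨ +-∸-assoc E ε≤ ⟩
  E + (2 * p + 1 ∸ ε)      ∎
  where
  open ≡-Reasoning
  w+2p : w + 2 * p ≡ 2 * q + 2 + ε
  w+2p = trans (cong (_+ 2 * p) w≡) (m∸n+n≡m 2p≤)
  balance : x + ε + (w + q + 2 * p) ≡ E + (2 * p + 1) + (w + q + 2 * p)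
  balance = begin
    x + ε + (w + q + 2 * p)               ≡⟨ regroup₁ x ε w q (2 * p) ⟩
    w + q + x + (2 * p + ε)               ≡⟨ cong (_+ (2 * p + ε)) counted ⟨
    E + 3 * suc q + (2 * p + ε)           ≡⟨ regroup₂ E q (2 * p) ε ⟩
    E + (2 * p + 1) + q + (2 * q + 2 + ε) ≡⟨ cong (E + (2 * p + 1) + q +_) w+2p ⟨
    E + (2 * p + 1) + q + (w + 2 * p)     ≡⟨ regroup₃ E (2 * p + 1) q w (2 * p) ⟩
    E + (2 * p + 1) + (w + q + 2 * p)     ∎
    where
    regroup₁ : ∀ x ε w q t → x + ε + (w + q + t) ≡ w + q + x + (t + ε)
    regroup₁ = solve-∀
    regroup₂ : ∀ E q t ε → E + 3 * suc q + (t + ε) ≡ E + (t + 1) + q + (2 * q + 2 + ε)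
    regroup₂ = solve-∀
    regroup₃ : ∀ E s q w t → E + s + q + (w + t) ≡ E + s + (w + q + t)
    regroup₃ = solve-∀

∸-of-split : ∀ {x y q ε s} → x + y ≡ q → x + ε ≡ s → y ≡ q + ε ∸ s
∸-of-split {x} {y} {q} {ε} {s} x+y≡q x+ε≡s = begin
  y                  ≡⟨ m+n∸n≡m y s ⟨
  y + s ∸ s          ≡⟨ cong (λ t → y + t ∸ s) x+ε≡s ⟨
  y + (x + ε) ∸ s    ≡⟨ cong (_∸ s) (trans (sym (+-assoc y x ε)) (cong (_+ ε) (trans (+-comm y x) x+y≡q))) ⟩
  q + ε ∸ s          ∎
  where open ≡-Reasoning

-- The lines through a point of K_λ

module LinesThrough {n p : ℕ} (Π : ProjectivePlane n) (c : Point n → Fin p) (dual : InDual Π c)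
  {l : ℕ} (0<l : 0 < l) (l<p : l < p) (l≢p∸l : l ≢ p ∸ l)
  (P : Point n) (P∈Kl : inK Π c l P ≡ true) where

  open ProjectivePlane Π

  val : Point n → ℕ
  val Q = toℕ (c Q)

  S : Point n → Bool
  S = inS Π c

  K[p∸l] : Point n → Bool
  K[p∸l] = inK Π c (p ∸ l)

  val-P : val P ≡ l
  val-P = ≡ᵇ-true⇒≡ P∈Kl

  P∈S : S P ≡ true
  P∈S = >0⇒≢0-true (val P) (subst (0 <_) (sym val-P) 0<l)

  K[p∸l]⊆S : ∀ {Q} → K[p∸l] Q ≡ true → S Q ≡ true
  K[p∸l]⊆S {Q} Q∈K = >0⇒≢0-true (val Q) (subst (0 <_) (sym (≡ᵇ-true⇒≡ Q∈K)) (m<n⇒0<n∸m l<p))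

  K[p∸l]-≢P : ∀ {Q} → K[p∸l] Q ≡ true → Q ≢ P
  K[p∸l]-≢P Q∈K refl = l≢p∸l (trans (sym val-P) (≡ᵇ-true⇒≡ Q∈K))

  throughP : Line n → Bool
  throughP ℓ = I P ℓ

  [_]-secant : ℕ → Line n → ℕ
  [ k ]-secant ℓ = 𝟙 (secant Π c ℓ ≡ᵇ k)

  others : Line n → Point n → Bool
  others ℓ = (λ Q → I Q ℓ ∧ S Q) without P

  nComplements : Line n → ℕ
  nComplements ℓ = count (λ Q → I Q ℓ ∧ K[p∸l] Q)

  excess : Line n → ℕ
  excess ℓ = secantExcess (secant Π c ℓ)

  totalExcess : ℕ
  totalExcess = sumOver throughP excess

  secant≡1+others : ∀ ℓ → I P ℓ ≡ true → secant Π c ℓ ≡ suc (count (others ℓ))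
  secant≡1+others ℓ P∈ℓ = count-without (λ Q → I Q ℓ ∧ S Q) (∧-intro P∈ℓ P∈S)

  line-sum : ∀ ℓ → I P ℓ ≡ true → p ∣ l + sumOver (others ℓ) val
  line-sum ℓ P∈ℓ = subst (p ∣_) sum≡ (dual ℓ)
    where
    open ≡-Reasoning
    sum≡ : sumOver (λ Q → I Q ℓ) val ≡ l + sumOver (others ℓ) val
    sum≡ = begin
      sumOver (λ Q → I Q ℓ) val        ≡⟨ sumOver-restrict (λ Q → I Q ℓ) S val (λ Q → ≢0-false⇒≡0 (val Q)) ⟩
      sumOver (λ Q → I Q ℓ ∧ S Q) val  ≡⟨ sumOver-without (λ Q → I Q ℓ ∧ S Q) val (∧-intro P∈ℓ P∈S) ⟩
      val P + sumOver (others ℓ) val   ≡⟨ cong (_+ sumOver (others ℓ) val) val-P ⟩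
      l + sumOver (others ℓ) val       ∎

  no-tangent : ∀ ℓ → I P ℓ ≡ true → 2 ≤ secant Π c ℓ
  no-tangent ℓ P∈ℓ with count (others ℓ) in others≡ | secant≡1+others ℓ P∈ℓ
  ... | suc _ | secant≡ = subst (2 ≤_) (sym secant≡) (s≤s (s≤s z≤n))
  ... | zero  | _       = ⊥-elim (>⇒∤ {{>-nonZero 0<l}} l<p (subst (p ∣_) l+0≡l (line-sum ℓ P∈ℓ)))
    where
    l+0≡l : l + sumOver (others ℓ) val ≡ l
    l+0≡l = trans (cong (l +_) (sumOver-count≡0 (others ℓ) val others≡)) (+-identityʳ l)

  complement-on-2-secant : ∀ ℓ {Q} → I P ℓ ≡ true → secant Π c ℓ ≡ 2 → others ℓ Q ≡ true →
    val Q ≡ p ∸ l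
  complement-on-2-secant ℓ {Q} P∈ℓ secant≡2 Q∈others =
    ∣a+b⇒b≡p∸a 0<l l<p (toℕ<n (c Q))
      (subst (λ s → p ∣ l + s) (sumOver-single (others ℓ) val Q∈others one-other) (line-sum ℓ P∈ℓ))
    where
    one-other : count (others ℓ) ≡ 1
    one-other = suc-injective (trans (sym (secant≡1+others ℓ P∈ℓ)) secant≡2)

  complement∈others : ∀ ℓ {Q} → I Q ℓ ≡ true → K[p∸l] Q ≡ true → others ℓ Q ≡ true
  complement∈others ℓ Q∈ℓ Q∈K =
    ∈-without {f = λ R → I R ℓ ∧ S R} (∧-intro Q∈ℓ (K[p∸l]⊆S Q∈K)) (K[p∸l]-≢P Q∈K)

  no-complement-on-3-secant : ∀ ℓ {Q} → I P ℓ ≡ true → secant Π c ℓ ≡ 3 →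
    I Q ℓ ≡ true → K[p∸l] Q ≡ true → ⊥
  no-complement-on-3-secant ℓ {Q} P∈ℓ secant≡3 Q∈ℓ Q∈K =
    p∤p+b (≢0-true⇒>0 (val Z) Z∈S) (toℕ<n (c Z)) (subst (p ∣_) sum≡ (line-sum ℓ P∈ℓ))
    where
    open ≡-Reasoning
    Q∈others : others ℓ Q ≡ true
    Q∈others = complement∈others ℓ Q∈ℓ Q∈K
    rest : Point n → Bool
    rest = others ℓ without Q
    one-rest : count rest ≡ 1
    one-rest = suc-injective (trans (sym (count-without (others ℓ) Q∈others))
                                    (suc-injective (trans (sym (secant≡1+others ℓ P∈ℓ)) secant≡3)))
    Z : Point n
    Z = proj₁ (count-pos rest one-rest)
    Z∈rest : rest Z ≡ true
    Z∈rest = proj₂ (count-pos rest one-rest)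
    Z∈S : S Z ≡ true
    Z∈S = proj₂ (∧-true (without-⊆ {f = λ R → I R ℓ ∧ S R} (without-⊆ {f = others ℓ} Z∈rest)))
    sum≡ : l + sumOver (others ℓ) val ≡ p + val Z
    sum≡ = begin
      l + sumOver (others ℓ) val      ≡⟨ cong (l +_) (sumOver-without (others ℓ) val Q∈others) ⟩
      l + (val Q + sumOver rest val)  ≡⟨ cong₂ (λ u v → l + (u + v)) (≡ᵇ-true⇒≡ Q∈K)
                                                                     (sumOver-single rest val Z∈rest one-rest) ⟩
      l + ((p ∸ l) + val Z)           ≡⟨ +-assoc l (p ∸ l) (val Z) ⟨
      l + (p ∸ l) + val Z             ≡⟨ cong (_+ val Z) (m+[n∸m]≡n (<⇒≤ l<p)) ⟩
      p + val Z                       ∎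

  nComplements-2-secant : ∀ ℓ → I P ℓ ≡ true → secant Π c ℓ ≡ 2 → nComplements ℓ ≡ 1
  nComplements-2-secant ℓ P∈ℓ secant≡2 = begin
    nComplements ℓ    ≡⟨ ≤-antisym (count-mono complements⊆others) (count-mono others⊆complements) ⟩
    count (others ℓ)  ≡⟨ suc-injective (trans (sym (secant≡1+others ℓ P∈ℓ)) secant≡2) ⟩
    1                 ∎
    where
    open ≡-Reasoning
    complements⊆others : ∀ Q → I Q ℓ ∧ K[p∸l] Q ≡ true → others ℓ Q ≡ true
    complements⊆others Q Q∈ = let Q∈ℓ , Q∈K = ∧-true Q∈ in complement∈others ℓ Q∈ℓ Q∈K
    others⊆complements : ∀ Q → others ℓ Q ≡ true → I Q ℓ ∧ K[p∸l] Q ≡ true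
    others⊆complements Q Q∈others = ∧-intro
      (proj₁ (∧-true (without-⊆ {f = λ R → I R ℓ ∧ S R} Q∈others)))
      (≡⇒≡ᵇ-true (complement-on-2-secant ℓ P∈ℓ secant≡2 Q∈others))

  nComplements-3-secant : ∀ ℓ → I P ℓ ≡ true → secant Π c ℓ ≡ 3 → nComplements ℓ ≡ 0
  nComplements-3-secant ℓ P∈ℓ secant≡3 = count-none (λ Q → I Q ℓ ∧ K[p∸l] Q) λ Q Q∈ →
    let Q∈ℓ , Q∈K = ∧-true Q∈ in no-complement-on-3-secant ℓ P∈ℓ secant≡3 Q∈ℓ Q∈K

  2-secant≤nComplements : ∀ ℓ → I P ℓ ≡ true → [ 2 ]-secant ℓ ≤ nComplements ℓ
  2-secant≤nComplements ℓ P∈ℓ with secant Π c ℓ ≡ᵇ 2 in is2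
  ... | true  = ≤-reflexive (sym (nComplements-2-secant ℓ P∈ℓ (≡ᵇ-true⇒≡ is2)))
  ... | false = z≤n

  nComplements-2-or-3-secant : ∀ ℓ → I P ℓ ≡ true → (secant Π c ℓ ≡ 2) ⊎ (secant Π c ℓ ≡ 3) →
    nComplements ℓ ≡ [ 2 ]-secant ℓ
  nComplements-2-or-3-secant ℓ P∈ℓ (inj₁ secant≡2) rewrite secant≡2 =
    nComplements-2-secant ℓ P∈ℓ secant≡2
  nComplements-2-or-3-secant ℓ P∈ℓ (inj₂ secant≡3) rewrite secant≡3 =
    nComplements-3-secant ℓ P∈ℓ secant≡3

  weight≡1+others : weight Π c ≡ suc (sumOver throughP (count ∘ others))
  weight≡1+others = begin
    weight Π c
      ≡⟨ count-without S P∈S ⟩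
    suc (count (S without P))
      ≡⟨ cong suc (count-by-linesThrough Π P (S without P) (without-self S P)) ⟩
    suc (sumOver throughP (λ ℓ → count (λ Q → I Q ℓ ∧ (S without P) Q)))
      ≡⟨ cong suc (sumOver-cong throughP λ ℓ _ → count-cong (∧-without (λ Q → I Q ℓ) S P)) ⟩
    suc (sumOver throughP (count ∘ others))
      ∎
    where open ≡-Reasoning

  sumOver-secant≡weight+n : .{{NonZero n}} → sumOver throughP (secant Π c) ≡ weight Π c + n
  sumOver-secant≡weight+n = begin
    sumOver throughP (secant Π c)
      ≡⟨ sumOver-cong throughP (λ ℓ P∈ℓ → trans (secant≡1+others ℓ P∈ℓ) (+-comm 1 _)) ⟩
    sumOver throughP (λ ℓ → count (others ℓ) + 1)
      ≡⟨ sumOver-+ throughP (count ∘ others) (λ _ → 1) ⟩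
    sumOver throughP (count ∘ others) + sumOver throughP (λ _ → 1)
      ≡⟨ cong (sumOver throughP (count ∘ others) +_)
              (trans (sym (count-as-sumOver throughP)) (count-linesThrough Π P)) ⟩
    sumOver throughP (count ∘ others) + suc n
      ≡⟨ +-suc _ n ⟩
    suc (sumOver throughP (count ∘ others)) + n
      ≡⟨ cong (_+ n) weight≡1+others ⟨
    weight Π c + n
      ∎
    where open ≡-Reasoning

  sizeK≡sumOver-nComplements : sizeK Π c (p ∸ l) ≡ sumOver throughP nComplements
  sizeK≡sumOver-nComplements =
    count-by-linesThrough Π P K[p∸l] (≢⇒≡ᵇ-false (λ e → l≢p∸l (trans (sym val-P) e)))

  nSecantsThrough-as-sumOver : ∀ k → nSecantsThrough Π c k P ≡ sumOver throughP [ k ]-secant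
  nSecantsThrough-as-sumOver k = count-∧ throughP (λ ℓ → secant Π c ℓ ≡ᵇ k)

  x≤sizeK : x Π c P ≤ sizeK Π c (p ∸ l)
  x≤sizeK = subst₂ _≤_ (sym (nSecantsThrough-as-sumOver 2)) (sym sizeK≡sumOver-nComplements)
                       (sumOver-mono-≤ throughP 2-secant≤nComplements)

  totalExcess+3*[1+n]≡weight+n+x : .{{NonZero n}} → totalExcess + 3 * suc n ≡ weight Π c + n + x Π c P
  totalExcess+3*[1+n]≡weight+n+x = begin
    totalExcess + 3 * suc n
      ≡⟨ cong (totalExcess +_) (trans (sumOver-const throughP 3) (cong (3 *_) (count-linesThrough Π P))) ⟨
    totalExcess + sumOver throughP (λ _ → 3)
      ≡⟨ sumOver-+ throughP excess (λ _ → 3) ⟨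
    sumOver throughP (λ ℓ → excess ℓ + 3)
      ≡⟨ sumOver-cong throughP (λ ℓ P∈ℓ → secantExcess-+3 (secant Π c ℓ) (no-tangent ℓ P∈ℓ)) ⟩
    sumOver throughP (λ ℓ → secant Π c ℓ + [ 2 ]-secant ℓ)
      ≡⟨ sumOver-+ throughP (secant Π c) [ 2 ]-secant ⟩
    sumOver throughP (secant Π c) + sumOver throughP [ 2 ]-secant
      ≡⟨ cong₂ _+_ sumOver-secant≡weight+n (sym (nSecantsThrough-as-sumOver 2)) ⟩
    weight Π c + n + x Π c P
      ∎
    where open ≡-Reasoning

  TwoOrThreeSecants : Set
  TwoOrThreeSecants = ∀ ℓ → I P ℓ ≡ true → (secant Π c ℓ ≡ 2) ⊎ (secant Π c ℓ ≡ 3)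

  totalExcess≡0⇒TwoOrThreeSecants : totalExcess ≡ 0 → TwoOrThreeSecants
  totalExcess≡0⇒TwoOrThreeSecants Σ≡0 ℓ P∈ℓ = secantExcess≡0 (secant Π c ℓ) (no-tangent ℓ P∈ℓ)
    (n≤0⇒n≡0 (subst (excess ℓ ≤_) Σ≡0 (sumOver-term-≤ throughP excess P∈ℓ)))

  TwoOrThreeSecants⇒sizeK≡x : TwoOrThreeSecants → sizeK Π c (p ∸ l) ≡ x Π c P
  TwoOrThreeSecants⇒sizeK≡x twoOrThree = begin
    sizeK Π c (p ∸ l)               ≡⟨ sizeK≡sumOver-nComplements ⟩
    sumOver throughP nComplements   ≡⟨ sumOver-cong throughP (λ ℓ P∈ℓ →
                                         nComplements-2-or-3-secant ℓ P∈ℓ (twoOrThree ℓ P∈ℓ)) ⟩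
    sumOver throughP [ 2 ]-secant   ≡⟨ nSecantsThrough-as-sumOver 2 ⟨
    x Π c P                         ∎
    where open ≡-Reasoning

  OnTwoSecantThroughP : Point n → Set
  OnTwoSecantThroughP Q =
    (Q ≢ P) × (S Q ≡ true) × Σ (Line n) (λ ℓ → (I P ℓ ≡ true) × (I Q ℓ ≡ true) × (secant Π c ℓ ≡ 2))

  TwoOrThreeSecants⇒K[p∸l]⇔OnTwoSecantThroughP : TwoOrThreeSecants →
    ∀ Q → (K[p∸l] Q ≡ true) ⇔ OnTwoSecantThroughP Q
  TwoOrThreeSecants⇒K[p∸l]⇔OnTwoSecantThroughP twoOrThree Q = mk⇔ to from
    where
    to : K[p∸l] Q ≡ true → OnTwoSecantThroughP Q
    to Q∈K with joinLine P Q (K[p∸l]-≢P Q∈K ∘ sym)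
    ... | ℓ , P∈ℓ , Q∈ℓ , _ with twoOrThree ℓ P∈ℓ
    ...   | inj₁ secant≡2 = K[p∸l]-≢P Q∈K , K[p∸l]⊆S Q∈K , ℓ , P∈ℓ , Q∈ℓ , secant≡2
    ...   | inj₂ secant≡3 = ⊥-elim (no-complement-on-3-secant ℓ P∈ℓ secant≡3 Q∈ℓ Q∈K)
    from : OnTwoSecantThroughP Q → K[p∸l] Q ≡ true
    from (Q≢P , Q∈S , ℓ , P∈ℓ , Q∈ℓ , secant≡2) = ≡⇒≡ᵇ-true
      (complement-on-2-secant ℓ P∈ℓ secant≡2
        (∈-without {f = λ R → I R ℓ ∧ S R} (∧-intro Q∈ℓ Q∈S) Q≢P))

  totalExcess≡1⇒one-4-secant : .{{NonZero n}} → totalExcess ≡ 1 →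
    (nSecantsThrough Π c 4 P ≡ 1) × (x Π c P + nSecantsThrough Π c 3 P + nSecantsThrough Π c 4 P ≡ suc n)
  totalExcess≡1⇒one-4-secant Σ≡1 = n₄≡1 , partition
    where
    open ≡-Reasoning
    kinds : ∀ ℓ → I P ℓ ≡ true →
      ([ 2 ]-secant ℓ + [ 3 ]-secant ℓ + [ 4 ]-secant ℓ ≡ 1) × ([ 4 ]-secant ℓ ≡ excess ℓ)
    kinds ℓ P∈ℓ = secantExcess≤1 (secant Π c ℓ) (no-tangent ℓ P∈ℓ)
      (subst (excess ℓ ≤_) Σ≡1 (sumOver-term-≤ throughP excess P∈ℓ))
    n₄≡1 : nSecantsThrough Π c 4 P ≡ 1
    n₄≡1 = begin
      nSecantsThrough Π c 4 P        ≡⟨ nSecantsThrough-as-sumOver 4 ⟩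
      sumOver throughP [ 4 ]-secant  ≡⟨ sumOver-cong throughP (λ ℓ P∈ℓ → proj₂ (kinds ℓ P∈ℓ)) ⟩
      totalExcess                    ≡⟨ Σ≡1 ⟩
      1                              ∎
    partition : x Π c P + nSecantsThrough Π c 3 P + nSecantsThrough Π c 4 P ≡ suc n
    partition = begin
      x Π c P + nSecantsThrough Π c 3 P + nSecantsThrough Π c 4 P
        ≡⟨ cong₂ _+_ (cong₂ _+_ (nSecantsThrough-as-sumOver 2) (nSecantsThrough-as-sumOver 3))
                     (nSecantsThrough-as-sumOver 4) ⟩
      sumOver throughP [ 2 ]-secant + sumOver throughP [ 3 ]-secant + sumOver throughP [ 4 ]-secant
        ≡⟨ cong (_+ sumOver throughP [ 4 ]-secant) (sumOver-+ throughP [ 2 ]-secant [ 3 ]-secant) ⟨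
      sumOver throughP (λ ℓ → [ 2 ]-secant ℓ + [ 3 ]-secant ℓ) + sumOver throughP [ 4 ]-secant
        ≡⟨ sumOver-+ throughP (λ ℓ → [ 2 ]-secant ℓ + [ 3 ]-secant ℓ) [ 4 ]-secant ⟨
      sumOver throughP (λ ℓ → [ 2 ]-secant ℓ + [ 3 ]-secant ℓ + [ 4 ]-secant ℓ)
        ≡⟨ sumOver-cong throughP (λ ℓ P∈ℓ → proj₁ (kinds ℓ P∈ℓ)) ⟩
      sumOver throughP (λ _ → 1)
        ≡⟨ count-as-sumOver throughP ⟨
      count throughP
        ≡⟨ count-linesThrough Π P ⟩
      suc n
        ∎

-- Codewords of weight 2p² − 2p + 2 + ε

module LowWeight {p : ℕ} (p-prime : Prime p) (3≤p : 3 ≤ p)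
  (Π : ProjectivePlane (p * p)) (c : Point (p * p) → Fin p) (dual : InDual Π c)
  {ε : ℕ} (ε≤p∸2 : ε ≤ p ∸ 2) (weight≡ : weight Π c ≡ 2 * (p * p) + 2 + ε ∸ 2 * p)
  {l : ℕ} (1≤l : 1 ≤ l) (l<p : l < p) where

  instance
    p≢0 : NonZero p
    p≢0 = >-nonZero (≤-trans (s≤s z≤n) 3≤p)
    p*p≢0 : NonZero (p * p)
    p*p≢0 = m*n≢0 p p

  open LinesThrough Π c dual 1≤l l<p (odd-prime⇒l≢p∸l p-prime 3≤p (<⇒≤ l<p)) public

  ε≤2p+1 : ε ≤ 2 * p + 1
  ε≤2p+1 = ≤-trans ε≤p∸2 (≤-trans (m∸n≤m p 2) (≤-trans (m≤m+n p (p + 0)) (m≤m+n (2 * p) 1)))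

  2p+2∸ε≡1+[2p+1∸ε] : 2 * p + 2 ∸ ε ≡ suc (2 * p + 1 ∸ ε)
  2p+2∸ε≡1+[2p+1∸ε] = trans (cong (_∸ ε) (+-suc (2 * p) 1)) (+-∸-assoc 1 ε≤2p+1)

  x≡totalExcess+[2p+1∸ε] : ∀ P (P∈K : inK Π c l P ≡ true) →
    x Π c P ≡ totalExcess P P∈K + (2 * p + 1 ∸ ε)
  x≡totalExcess+[2p+1∸ε] P P∈K =
    excess-balance {q = p * p} {p = p} (totalExcess+3*[1+n]≡weight+n+x P P∈K) weight≡ 2p≤ ε≤2p+1
    where
    2p≤ : 2 * p ≤ 2 * (p * p) + 2 + ε
    2p≤ = ≤-trans (*-monoʳ-≤ 2 (m≤m*n p p)) (≤-trans (m≤m+n _ 2) (m≤m+n _ ε))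

  sizeK≡2p+1∸ε⇒x≡ : sizeK Π c (p ∸ l) ≡ 2 * p + 1 ∸ ε →
    ∀ P → inK Π c l P ≡ true → x Π c P ≡ 2 * p + 1 ∸ ε
  sizeK≡2p+1∸ε⇒x≡ sizeK≡ P P∈K = ≤-antisym
    (subst (x Π c P ≤_) sizeK≡ (x≤sizeK P P∈K))
    (subst (2 * p + 1 ∸ ε ≤_) (sym (x≡totalExcess+[2p+1∸ε] P P∈K)) (m≤n+m _ _))

  x≡2p+1∸ε⇒TwoOrThreeSecants : ∀ P (P∈K : inK Π c l P ≡ true) →
    x Π c P ≡ 2 * p + 1 ∸ ε → TwoOrThreeSecants P P∈K
  x≡2p+1∸ε⇒TwoOrThreeSecants P P∈K x≡ = totalExcess≡0⇒TwoOrThreeSecants P P∈K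
    (+-cancelʳ-≡ (2 * p + 1 ∸ ε) _ 0 (trans (sym (x≡totalExcess+[2p+1∸ε] P P∈K)) x≡))

  sizeK≡2p+2∸ε⇒totalExcess≡1 : sizeK Π c (p ∸ l) ≡ 2 * p + 2 ∸ ε →
    ∀ P (P∈K : inK Π c l P ≡ true) → totalExcess P P∈K ≡ 1
  sizeK≡2p+2∸ε⇒totalExcess≡1 sizeK≡ P P∈K = ≤-antisym E≤1 (n≢0⇒n>0 E≢0)
    where
    a E : ℕ
    a = 2 * p + 1 ∸ ε
    E = totalExcess P P∈K
    sizeK≡1+a : sizeK Π c (p ∸ l) ≡ suc a
    sizeK≡1+a = trans sizeK≡ 2p+2∸ε≡1+[2p+1∸ε]
    E≤1 : E ≤ 1
    E≤1 = +-cancelʳ-≤ a E 1 (subst₂ _≤_ (x≡totalExcess+[2p+1∸ε] P P∈K) sizeK≡1+a (x≤sizeK P P∈K))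
    E≢0 : E ≢ 0
    E≢0 E≡0 = 1+n≢n (begin
      suc a              ≡⟨ sizeK≡1+a ⟨
      sizeK Π c (p ∸ l)  ≡⟨ TwoOrThreeSecants⇒sizeK≡x P P∈K (totalExcess≡0⇒TwoOrThreeSecants P P∈K E≡0) ⟩
      x Π c P            ≡⟨ x≡totalExcess+[2p+1∸ε] P P∈K ⟩
      E + a              ≡⟨ cong (_+ a) E≡0 ⟩
      a                  ∎)
      where open ≡-Reasoning

  sizeK≡2p+2∸ε⇒x≡ : sizeK Π c (p ∸ l) ≡ 2 * p + 2 ∸ ε →
    ∀ P → inK Π c l P ≡ true → x Π c P ≡ 2 * p + 2 ∸ ε
  sizeK≡2p+2∸ε⇒x≡ sizeK≡ P P∈K = begin
    x Π c P                              ≡⟨ x≡totalExcess+[2p+1∸ε] P P∈K ⟩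
    totalExcess P P∈K + (2 * p + 1 ∸ ε)  ≡⟨ cong (_+ (2 * p + 1 ∸ ε))
                                                 (sizeK≡2p+2∸ε⇒totalExcess≡1 sizeK≡ P P∈K) ⟩
    suc (2 * p + 1 ∸ ε)                  ≡⟨ 2p+2∸ε≡1+[2p+1∸ε] ⟨
    2 * p + 2 ∸ ε                        ∎
    where open ≡-Reasoning

  sizeK≡2p+2∸ε⇒secant-counts : sizeK Π c (p ∸ l) ≡ 2 * p + 2 ∸ ε → ∀ P → inK Π c l P ≡ true →
    (nSecantsThrough Π c 3 P ≡ p * p + ε ∸ (2 * p + 2)) × (nSecantsThrough Π c 4 P ≡ 1)
  sizeK≡2p+2∸ε⇒secant-counts sizeK≡ P P∈K = ∸-of-split x+n₃≡p*p x+ε≡2p+2 , n₄≡1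
    where
    n₂ n₃ n₄ : ℕ
    n₂ = x Π c P
    n₃ = nSecantsThrough Π c 3 P
    n₄ = nSecantsThrough Π c 4 P
    one-4-secant : (n₄ ≡ 1) × (n₂ + n₃ + n₄ ≡ suc (p * p))
    one-4-secant = totalExcess≡1⇒one-4-secant P P∈K (sizeK≡2p+2∸ε⇒totalExcess≡1 sizeK≡ P P∈K)
    n₄≡1 : n₄ ≡ 1
    n₄≡1 = proj₁ one-4-secant
    x+n₃≡p*p : n₂ + n₃ ≡ p * p
    x+n₃≡p*p = suc-injective (begin
      suc (n₂ + n₃)    ≡⟨ +-comm 1 (n₂ + n₃) ⟩
      n₂ + n₃ + 1      ≡⟨ cong (n₂ + n₃ +_) n₄≡1 ⟨
      n₂ + n₃ + n₄     ≡⟨ proj₂ one-4-secant ⟩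
      suc (p * p)      ∎)
      where open ≡-Reasoning
    x+ε≡2p+2 : n₂ + ε ≡ 2 * p + 2
    x+ε≡2p+2 = trans (cong (_+ ε) (sizeK≡2p+2∸ε⇒x≡ sizeK≡ P P∈K))
                     (m∸n+n≡m (≤-trans ε≤2p+1 (+-monoʳ-≤ (2 * p) (n≤1+n 1))))

mainTheorem17 : ∀ (p : ℕ) → Prime p → 3 ≤ p →
    (Π : ProjectivePlane (p * p)) → (c : Point (p * p) → Fin p) → InDual Π c →
    (ε : ℕ) → 1 ≤ ε → ε ≤ p ∸ 2 →
    weight Π c ≡ 2 * (p * p) + 2 + ε ∸ 2 * p →
    (l : ℕ) → 1 ≤ l → l < p →
    -- (i)
    (∀ A → inK Π c l A ≡ true → x Π c A ≤ sizeK Π c (p ∸ l))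
    -- (ii)
    × (sizeK Π c (p ∸ l) ≡ 2 * p + 1 ∸ ε →
        ∀ P → inK Π c l P ≡ true → x Π c P ≡ 2 * p + 1 ∸ ε)
    -- (iii)
    × (∀ P → inK Π c l P ≡ true → x Π c P ≡ 2 * p + 1 ∸ ε →
        (sizeK Π c (p ∸ l) ≡ 2 * p + 1 ∸ ε)
        × (∀ ℓ → ProjectivePlane.I Π P ℓ ≡ true → (secant Π c ℓ ≡ 2) ⊎ (secant Π c ℓ ≡ 3))
        × (∀ Q → (inK Π c (p ∸ l) Q ≡ true) ⇔
             ((Q ≢ P) × (inS Π c Q ≡ true) ×
              Σ (Line (p * p)) (λ ℓ → (ProjectivePlane.I Π P ℓ ≡ true)
                × (ProjectivePlane.I Π Q ℓ ≡ true) × (secant Π c ℓ ≡ 2)))))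
    -- (iv)
    × (sizeK Π c (p ∸ l) ≡ 2 * p + 2 ∸ ε →
        ∀ P → inK Π c l P ≡ true →
          (x Π c P ≡ 2 * p + 2 ∸ ε)
          × (nSecantsThrough Π c 2 P ≡ 2 * p + 2 ∸ ε)
          × (nSecantsThrough Π c 3 P ≡ p * p + ε ∸ (2 * p + 2))
          × (nSecantsThrough Π c 4 P ≡ 1))
mainTheorem17 p p-prime 3≤p Π c dual ε _ ε≤p∸2 weight≡ l 1≤l l<p =
    x≤sizeK
  , sizeK≡2p+1∸ε⇒x≡
  , (λ P P∈K x≡ → let twoOrThree = x≡2p+1∸ε⇒TwoOrThreeSecants P P∈K x≡ in
        trans (TwoOrThreeSecants⇒sizeK≡x P P∈K twoOrThree) x≡
      , twoOrThree
      , TwoOrThreeSecants⇒K[p∸l]⇔OnTwoSecantThroughP P P∈K twoOrThree)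
  , (λ sizeK≡ P P∈K → let x≡ = sizeK≡2p+2∸ε⇒x≡ sizeK≡ P P∈K in
        x≡ , x≡ , sizeK≡2p+2∸ε⇒secant-counts sizeK≡ P P∈K)
  where open LowWeight p-prime 3≤p Π c dual ε≤p∸2 weight≡ 1≤l l<p
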